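{- Let $t$ be a term and $v$ a value. If $\pi$ is a derivation with conclusion $\Gamma,x\colon P\vdash t\colon Q$ and $\pi'$ is a derivation with conclusion $\Delta\vdash v\colon P$, then there is a derivation $\pi''$ with conclusion $\Gamma\uplus\Delta\vdash t\{v/x\}\colon Q$ such that $|\pi''|=|\pi|+|\pi'|$.
   Context: Terms: $t ::= x \mid \lambda x.t \mid tu$ up to $\alpha$-conversion; values are variables and abstractions; $t\{v/x\}$ is capture-avoiding substitution. Types: negative $N ::= P\multimap Q$; positive $P,Q ::= [N_1,\dots,N_n]$ finite multisets ($n\ge0$), $\mathbf{0}$ the empty multiset. Environments: maps from variables to positive types, $\mathbf{0}$ almost everywhere; $\uplus$ pointwise multiset sum; $\Gamma,x\colon P$ denotes the environment extending $\Gamma$ (with $\Gamma(x)=\mathbf{0}$) by $x\mapsto P$. Rules: (ax) $x\colon P\vdash x\colon P$; (@) from $\Gamma\vdash t\colon[P\multimap Q]$ and $\Gamma'\vdash u\colon P$ infer $\Gamma\uplus\Gamma'\vdash tu\colon Q$; ($\lambda$) for $n\ge0$, from $\Gamma_i,x\colon P_i\vdash t\colon Q_i$ ($1\le i\le n$) infer $\biguplus_i\Gamma_i\vdash\lambda x.t\colon[P_1\multimap Q_1,\dots,P_n\multimap Q_n]$. $|\pi|$ is the number of (@) rules in $\pi$. -}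

module Defs where

open import Data.Nat using (ℕ; zero; suc; _+_; _≡ᵇ_; _<ᵇ_)
open import Data.Bool using (if_then_else_)
open import Data.List using (List; []; _∷_; _++_; tabulate)
open import Data.Fin using (Fin)
import Data.Fin as Fin
open import Data.List.Relation.Binary.Permutation.Homogeneous using (Permutation)

-- Terms: pure λ-terms up to α-conversion, as de Bruijn terms.

data Term : Set where
  var : ℕ → Term
  ƛ_  : Term → Term
  _·_ : Term → Term → Term

infixl 7 _·_

data IsValue : Term → Set where
  var-val : ∀ {x} → IsValue (var x)
  lam-val : ∀ {t} → IsValue (ƛ t)

shift : ℕ → Term → Term
shift c (var y)  = if y <ᵇ c then var y else var (suc y)
shift c (ƛ t)    = ƛ shift (suc c) t
shift c (t · u)  = shift c t · shift c u

-- capture-avoiding substitution  t{v/x}  of v for the free variable x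
-- (other free variables keep their names, exactly as in the named setting)
_[_/_] : Term → Term → ℕ → Term
var y   [ v / x ] = if y ≡ᵇ x then v else var y
(ƛ t)   [ v / x ] = ƛ (t [ shift 0 v / suc x ])
(t · u) [ v / x ] = (t [ v / x ]) · (u [ v / x ])

-- Types.  Positive types are finite multisets of negative types,
-- represented by lists taken up to the (nested) multiset equality ≈P.

data Neg : Set where
  _⊸_ : List Neg → List Neg → Neg

Pos : Set
Pos = List Neg

𝟎 : Pos
𝟎 = []

data _≈N_ : Neg → Neg → Set where
  ⊸-cong : ∀ {P P′ Q Q′} → Permutation _≈N_ P P′ → Permutation _≈N_ Q Q′
         → (P ⊸ Q) ≈N (P′ ⊸ Q′)

_≈P_ : Pos → Pos → Set
_≈P_ = Permutation _≈N_

_⊎P_ : Pos → Pos → Pos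
_⊎P_ = _++_

Env : Set
Env = ℕ → Pos

_≈E_ : Env → Env → Set
Γ ≈E Δ = ∀ y → Γ y ≈P Δ y

_⊎_ : Env → Env → Env
(Γ ⊎ Δ) y = Γ y ⊎P Δ y

∅ : Env
∅ _ = 𝟎

⨄ : {n : ℕ} → (Fin n → Env) → Env
⨄ {zero}  Γs = ∅
⨄ {suc n} Γs = Γs Fin.zero ⊎ ⨄ (λ i → Γs (Fin.suc i))

-- Γ , x : P   (used when Γ x ≡ 𝟎)
_,_∶_ : Env → ℕ → Pos → Env
(Γ , x ∶ P) y = if y ≡ᵇ x then P else Γ y

_∶ₑ_ : ℕ → Pos → Env
x ∶ₑ P = ∅ , x ∶ P

_∷ₑ_ : Pos → Env → Env
(P ∷ₑ Γ) zero    = P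
(P ∷ₑ Γ) (suc y) = Γ y

-- Derivations.  Since types/environments are multisets, each rule may
-- conclude any representative equal (as multisets) to the rule's conclusion.

data _⊢_∶_ : Env → Term → Pos → Set where
  ax  : ∀ {Γ x P Q}
      → Γ ≈E (x ∶ₑ P) → Q ≈P P
      → Γ ⊢ var x ∶ Q
  app : ∀ {Γ₁ Γ₂ Γ t u P Q Q′}
      → Γ₁ ⊢ t ∶ ((P ⊸ Q) ∷ [])
      → Γ₂ ⊢ u ∶ P
      → Γ ≈E (Γ₁ ⊎ Γ₂) → Q′ ≈P Q
      → Γ ⊢ t · u ∶ Q′
  lam : ∀ {Γ t Q} (n : ℕ) (Ps Qs : Fin n → Pos) (Γs : Fin n → Env)
      → ((i : Fin n) → (Ps i ∷ₑ Γs i) ⊢ t ∶ Qs i)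
      → Γ ≈E ⨄ Γs → Q ≈P tabulate (λ i → Ps i ⊸ Qs i)
      → Γ ⊢ ƛ t ∶ Q

sumFin : (n : ℕ) → (Fin n → ℕ) → ℕ
sumFin zero    f = 0
sumFin (suc n) f = f Fin.zero + sumFin n (λ i → f (Fin.suc i))

size : ∀ {Γ t Q} → Γ ⊢ t ∶ Q → ℕ
size (ax _ _)               = 0
size (app π π′ _ _)         = suc (size π + size π′)
size (lam n Ps Qs Γs πs _ _) = sumFin n (λ i → size (πs i))

-- Generalise to Γ ⊢ t ∶ Q and Δ ⊢ v ∶ Γ x, and induct on the derivation of t.  A typing of
-- a value splits along any decomposition of its multiset type into typings whose environments
-- and sizes add up (for an abstraction: regroup the branches of its λ-rule).  At an application
-- or abstraction the typing of v is cut into one piece per premise, according to the share of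
-- Γ x that premise uses, and each piece is substituted into its premise.  At a variable either
-- x itself is replaced by the whole typing of v, or Γ x = 𝟎 and that typing is empty of size 0.
-- No (@) rule is ever created or erased, so sizes add exactly.

module Submission where

open import Defs
open import Algebra.Bundles using (CommutativeMonoid)
import Algebra.Properties.CommutativeSemigroup as CommutativeSemigroupProperties
open import Data.Bool using (true; false)
open import Data.Fin using (Fin) renaming (zero to fzero; suc to fsuc)
open import Data.List using ([]; _∷_; _++_; tabulate)
import Data.List.Relation.Binary.Permutation.Homogeneous as Perm
open import Data.List.Relation.Binary.Pointwise using (Pointwise; []; _∷_)
open import Data.Nat using (ℕ; zero; suc; _+_; _≡ᵇ_; _<ᵇ_)
open import Data.Nat.Properties using (_≟_; +-assoc; +-commutativeSemigroup)
open import Data.Vec.Functional using () renaming (_∷_ to _◂_)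
open import Data.Product using (Σ; _,_; proj₁; proj₂; _×_)
open import Relation.Binary.Bundles using (Setoid)
open import Relation.Binary.PropositionalEquality
  using (_≡_; _≢_; refl; sym; trans; cong; cong₂; subst)
import Relation.Binary.Reasoning.Setoid as SetoidReasoning
open import Relation.Nullary using (yes; no; contradiction)

mutual
  ≈N-refl : ∀ {N} → N ≈N N
  ≈N-refl {P ⊸ Q} = ⊸-cong ≈P-refl ≈P-refl

  ≈P-refl : ∀ {P} → P ≈P P
  ≈P-refl {[]}    = Perm.refl []
  ≈P-refl {N ∷ P} = Perm.prep ≈N-refl ≈P-refl

-- Perm.sym ≈N-sym is not structurally recursive, hence the hand-written mutual recursion.
mutual
  ≈N-sym : ∀ {N M} → N ≈N M → M ≈N N
  ≈N-sym (⊸-cong p q) = ⊸-cong (≈P-sym p) (≈P-sym q)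

  ≈P-sym : ∀ {P Q} → P ≈P Q → Q ≈P P
  ≈P-sym (Perm.refl ps)       = Perm.refl (pointwise-sym ps)
  ≈P-sym (Perm.prep e p)      = Perm.prep (≈N-sym e) (≈P-sym p)
  ≈P-sym (Perm.swap e₁ e₂ p)  = Perm.swap (≈N-sym e₂) (≈N-sym e₁) (≈P-sym p)
  ≈P-sym (Perm.trans p q)     = Perm.trans (≈P-sym q) (≈P-sym p)

  pointwise-sym : ∀ {P Q} → Pointwise _≈N_ P Q → Pointwise _≈N_ Q P
  pointwise-sym []       = []
  pointwise-sym (e ∷ ps) = ≈N-sym e ∷ pointwise-sym ps

≈N-trans : ∀ {L M N} → L ≈N M → M ≈N N → L ≈N N
≈N-trans (⊸-cong p q) (⊸-cong p′ q′) = ⊸-cong (Perm.trans p p′) (Perm.trans q q′)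

Neg-setoid : Setoid _ _
Neg-setoid = record
  { Carrier       = Neg
  ; _≈_           = _≈N_
  ; isEquivalence = record { refl = ≈N-refl ; sym = ≈N-sym ; trans = ≈N-trans }
  }

open import Data.List.Relation.Binary.Permutation.Setoid Neg-setoid
  using (↭-refl; ↭-reflexive; ↭-sym; ↭-trans)
open import Data.List.Relation.Binary.Permutation.Setoid.Properties Neg-setoid
  using (++⁺; ++⁺ˡ; ++-identityʳ; ++-assoc; shifts; ++-commutativeMonoid)
open CommutativeSemigroupProperties (CommutativeMonoid.commutativeSemigroup ++-commutativeMonoid)
  using () renaming (interchange to ++-interchange)
open CommutativeSemigroupProperties +-commutativeSemigroup
  using () renaming (interchange to +-interchange; x∙yz≈y∙xz to +-shifts)

≈E-refl : ∀ {Γ} → Γ ≈E Γ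
≈E-refl _ = ↭-refl

≈E-sym : ∀ {Γ Δ} → Γ ≈E Δ → Δ ≈E Γ
≈E-sym e y = ↭-sym (e y)

≈E-trans : ∀ {Γ Δ Θ} → Γ ≈E Δ → Δ ≈E Θ → Γ ≈E Θ
≈E-trans e f y = ↭-trans (e y) (f y)

Env-setoid : Setoid _ _
Env-setoid = record
  { Carrier       = Env
  ; _≈_           = _≈E_
  ; isEquivalence = record { refl = ≈E-refl ; sym = ≈E-sym ; trans = ≈E-trans }
  }

module ≈E-Reasoning = SetoidReasoning Env-setoid

⊎-cong : ∀ {Γ Γ′ Δ Δ′} → Γ ≈E Γ′ → Δ ≈E Δ′ → (Γ ⊎ Δ) ≈E (Γ′ ⊎ Δ′)
⊎-cong e f y = ++⁺ (e y) (f y)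

⊎-interchange : ∀ Γ₁ Γ₂ Δ₁ Δ₂ → ((Γ₁ ⊎ Γ₂) ⊎ (Δ₁ ⊎ Δ₂)) ≈E ((Γ₁ ⊎ Δ₁) ⊎ (Γ₂ ⊎ Δ₂))
⊎-interchange Γ₁ Γ₂ Δ₁ Δ₂ y = ++-interchange (Γ₁ y) (Γ₂ y) (Δ₁ y) (Δ₂ y)

⊎-identityʳ : ∀ Γ → (Γ ⊎ ∅) ≈E Γ
⊎-identityʳ Γ y = ++-identityʳ (Γ y)

∷ₑ-cong : ∀ {P P′} Γ → P ≈P P′ → (P ∷ₑ Γ) ≈E (P′ ∷ₑ Γ)
∷ₑ-cong Γ p zero    = p
∷ₑ-cong Γ p (suc y) = ↭-refl

⨄-interchange : ∀ n (Γs Δs : Fin n → Env) → (⨄ Γs ⊎ ⨄ Δs) ≈E ⨄ (λ i → Γs i ⊎ Δs i)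
⨄-interchange zero    Γs Δs = ≈E-refl
⨄-interchange (suc n) Γs Δs =
  ≈E-trans (⊎-interchange (Γs fzero) (⨄ (λ i → Γs (fsuc i))) (Δs fzero) (⨄ (λ i → Δs (fsuc i))))
           (⊎-cong ≈E-refl (⨄-interchange n (λ i → Γs (fsuc i)) (λ i → Δs (fsuc i))))

≡ᵇ-refl : ∀ x → (x ≡ᵇ x) ≡ true
≡ᵇ-refl zero    = refl
≡ᵇ-refl (suc x) = ≡ᵇ-refl x

≢⇒≡ᵇ-false : ∀ {y x} → y ≢ x → (y ≡ᵇ x) ≡ false
≢⇒≡ᵇ-false {zero}  {zero}  y≢x = contradiction refl y≢x
≢⇒≡ᵇ-false {zero}  {suc x} y≢x = refl
≢⇒≡ᵇ-false {suc y} {zero}  y≢x = refl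
≢⇒≡ᵇ-false {suc y} {suc x} y≢x = ≢⇒≡ᵇ-false (λ y≡x → y≢x (cong suc y≡x))

,-here : ∀ Γ x P → (Γ , x ∶ P) x ≡ P
,-here Γ x P rewrite ≡ᵇ-refl x = refl

,-there : ∀ Γ x P {y} → y ≢ x → (Γ , x ∶ P) y ≡ Γ y
,-there Γ x P y≢x rewrite ≢⇒≡ᵇ-false y≢x = refl

_∖_ : Env → ℕ → Env
Γ ∖ x = Γ , x ∶ 𝟎

∖-cong : ∀ {Γ Γ′} x → Γ ≈E Γ′ → (Γ ∖ x) ≈E (Γ′ ∖ x)
∖-cong x e y with y ≡ᵇ x
... | true  = ↭-refl
... | false = e y

∖-⊎ : ∀ Γ Δ x → ((Γ ⊎ Δ) ∖ x) ≈E ((Γ ∖ x) ⊎ (Δ ∖ x))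
∖-⊎ Γ Δ x y with y ≡ᵇ x
... | true  = ↭-refl
... | false = ↭-refl

∖-⨄ : ∀ n (Γs : Fin n → Env) x → (⨄ Γs ∖ x) ≈E ⨄ (λ i → Γs i ∖ x)
∖-⨄ zero    Γs x y with y ≡ᵇ x
... | true  = ↭-refl
... | false = ↭-refl
∖-⨄ (suc n) Γs x =
  ≈E-trans (∖-⊎ (Γs fzero) (⨄ (λ i → Γs (fsuc i))) x)
           (⊎-cong ≈E-refl (∖-⨄ n (λ i → Γs (fsuc i)) x))

∖-fresh : ∀ {Γ} x → Γ x ≈P 𝟎 → (Γ ∖ x) ≈E Γ
∖-fresh {Γ} x Γx≈𝟎 y with y ≟ x
... | yes refl = subst (_≈P Γ y) (sym (,-here Γ y 𝟎)) (↭-sym Γx≈𝟎)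
... | no y≢x   = ↭-reflexive (,-there Γ x 𝟎 y≢x)

,-∖ : ∀ Γ x P → ((Γ , x ∶ P) ∖ x) ≈E (Γ ∖ x)
,-∖ Γ x P y with y ≡ᵇ x
... | true  = ↭-refl
... | false = ↭-refl

∶ₑ-∖ : ∀ x P → ((x ∶ₑ P) ∖ x) ≈E ∅
∶ₑ-∖ x P y with y ≡ᵇ x
... | true  = ↭-refl
... | false = ↭-refl

∶ₑ-cong : ∀ x {P P′} → P ≈P P′ → (x ∶ₑ P) ≈E (x ∶ₑ P′)
∶ₑ-cong x p y with y ≡ᵇ x
... | true  = p
... | false = ↭-refl

∶ₑ-++ : ∀ x P R → (x ∶ₑ (P ++ R)) ≈E ((x ∶ₑ P) ⊎ (x ∶ₑ R))
∶ₑ-++ x P R y with y ≡ᵇ x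
... | true  = ↭-refl
... | false = ↭-refl

∶ₑ-𝟎 : ∀ x → (x ∶ₑ 𝟎) ≈E ∅
∶ₑ-𝟎 x y with y ≡ᵇ x
... | true  = ↭-refl
... | false = ↭-refl

∷ₑ-∖-⊎ : ∀ P Γ Δ x → (P ∷ₑ ((Γ ∖ x) ⊎ Δ)) ≈E (((P ∷ₑ Γ) ∖ suc x) ⊎ (𝟎 ∷ₑ Δ))
∷ₑ-∖-⊎ P Γ Δ x zero    = ↭-sym (++-identityʳ P)
∷ₑ-∖-⊎ P Γ Δ x (suc y) = ↭-refl

Sized : Env → Term → Pos → ℕ → Set
Sized Γ t Q k = Σ (Γ ⊢ t ∶ Q) (λ π → size π ≡ k)

retype : ∀ {Γ Γ′ t Q Q′ k} → Sized Γ t Q k → Γ′ ≈E Γ → Q′ ≈P Q → Sized Γ′ t Q′ k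
retype (ax e q , refl)                 e′ q′ = ax (≈E-trans e′ e) (↭-trans q′ q) , refl
retype (app π₁ π₂ e q , refl)          e′ q′ = app π₁ π₂ (≈E-trans e′ e) (↭-trans q′ q) , refl
retype (lam n Ps Qs Γs πs e q , refl)  e′ q′ = lam n Ps Qs Γs πs (≈E-trans e′ e) (↭-trans q′ q) , refl

sumFin-cong : ∀ n {f g : Fin n → ℕ} → (∀ i → f i ≡ g i) → sumFin n f ≡ sumFin n g
sumFin-cong zero    f≡g = refl
sumFin-cong (suc n) f≡g = cong₂ _+_ (f≡g fzero) (sumFin-cong n (λ i → f≡g (fsuc i)))

sumFin-+ : ∀ n (f g : Fin n → ℕ) → sumFin n (λ i → f i + g i) ≡ sumFin n f + sumFin n g
sumFin-+ zero    f g = refl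
sumFin-+ (suc n) f g =
  trans (cong (f fzero + g fzero +_) (sumFin-+ n (λ i → f (fsuc i)) (λ i → g (fsuc i))))
        (+-interchange (f fzero) (g fzero) _ _)

-- insert𝟎 c Γ opens an untyped slot at index c, matching shift c.
insert𝟎 : ℕ → Env → Env
insert𝟎 zero    Γ = 𝟎 ∷ₑ Γ
insert𝟎 (suc c) Γ = Γ zero ∷ₑ insert𝟎 c (λ y → Γ (suc y))

insert𝟎-cong : ∀ c {Γ Γ′} → Γ ≈E Γ′ → insert𝟎 c Γ ≈E insert𝟎 c Γ′
insert𝟎-cong zero    e zero    = ↭-refl
insert𝟎-cong zero    e (suc y) = e y
insert𝟎-cong (suc c) e zero    = e zero
insert𝟎-cong (suc c) e (suc y) = insert𝟎-cong c (λ y → e (suc y)) y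

insert𝟎-∅ : ∀ c → insert𝟎 c ∅ ≈E ∅
insert𝟎-∅ zero    zero    = ↭-refl
insert𝟎-∅ zero    (suc y) = ↭-refl
insert𝟎-∅ (suc c) zero    = ↭-refl
insert𝟎-∅ (suc c) (suc y) = insert𝟎-∅ c y

insert𝟎-⊎ : ∀ c Γ Δ → insert𝟎 c (Γ ⊎ Δ) ≈E (insert𝟎 c Γ ⊎ insert𝟎 c Δ)
insert𝟎-⊎ zero    Γ Δ zero    = ↭-refl
insert𝟎-⊎ zero    Γ Δ (suc y) = ↭-refl
insert𝟎-⊎ (suc c) Γ Δ zero    = ↭-refl
insert𝟎-⊎ (suc c) Γ Δ (suc y) = insert𝟎-⊎ c (λ y → Γ (suc y)) (λ y → Δ (suc y)) y

insert𝟎-⨄ : ∀ n c (Γs : Fin n → Env) → insert𝟎 c (⨄ Γs) ≈E ⨄ (λ i → insert𝟎 c (Γs i))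
insert𝟎-⨄ zero    c Γs = insert𝟎-∅ c
insert𝟎-⨄ (suc n) c Γs =
  ≈E-trans (insert𝟎-⊎ c (Γs fzero) (⨄ (λ i → Γs (fsuc i))))
           (⊎-cong ≈E-refl (insert𝟎-⨄ n c (λ i → Γs (fsuc i))))

insert𝟎-∶ₑ-< : ∀ c x P → (x <ᵇ c) ≡ true → insert𝟎 c (x ∶ₑ P) ≈E (x ∶ₑ P)
insert𝟎-∶ₑ-< (suc c) zero    P x<c zero    = ↭-refl
insert𝟎-∶ₑ-< (suc c) zero    P x<c (suc y) = insert𝟎-∅ c y
insert𝟎-∶ₑ-< (suc c) (suc x) P x<c zero    = ↭-refl
insert𝟎-∶ₑ-< (suc c) (suc x) P x<c (suc y) = insert𝟎-∶ₑ-< c x P x<c y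

insert𝟎-∶ₑ-≥ : ∀ c x P → (x <ᵇ c) ≡ false → insert𝟎 c (x ∶ₑ P) ≈E (suc x ∶ₑ P)
insert𝟎-∶ₑ-≥ zero    x       P x≥c zero    = ↭-refl
insert𝟎-∶ₑ-≥ zero    x       P x≥c (suc y) = ↭-refl
insert𝟎-∶ₑ-≥ (suc c) (suc x) P x≥c zero    = ↭-refl
insert𝟎-∶ₑ-≥ (suc c) (suc x) P x≥c (suc y) = insert𝟎-∶ₑ-≥ c x P x≥c y

shift-⊢ : ∀ c {Γ t Q} (π : Γ ⊢ t ∶ Q) → Sized (insert𝟎 c Γ) (shift c t) Q (size π)
shift-⊢ c (ax {x = x} {P = P} e q) with x <ᵇ c in x<ᵇc
... | true  = ax (≈E-trans (insert𝟎-cong c e) (insert𝟎-∶ₑ-< c x P x<ᵇc)) q , refl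
... | false = ax (≈E-trans (insert𝟎-cong c e) (insert𝟎-∶ₑ-≥ c x P x<ᵇc)) q , refl
shift-⊢ c (app {Γ₁ = Γ₁} {Γ₂ = Γ₂} π₁ π₂ e q)
  with shift-⊢ c π₁ | shift-⊢ c π₂
... | ρ₁ , ρ₁-size | ρ₂ , ρ₂-size =
  app ρ₁ ρ₂ (≈E-trans (insert𝟎-cong c e) (insert𝟎-⊎ c Γ₁ Γ₂)) q ,
  cong₂ (λ k₁ k₂ → suc (k₁ + k₂)) ρ₁-size ρ₂-size
shift-⊢ c (lam n Ps Qs Γs πs e q) =
  lam n Ps Qs (λ i → insert𝟎 c (Γs i)) (λ i → proj₁ (shift-⊢ (suc c) (πs i)))
      (≈E-trans (insert𝟎-cong c e) (insert𝟎-⨄ n c Γs)) q ,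
  sumFin-cong n (λ i → proj₂ (shift-⊢ (suc c) (πs i)))

shift-Sized : ∀ c {Γ t Q k} → Sized Γ t Q k → Sized (insert𝟎 c Γ) (shift c t) Q k
shift-Sized c (π , refl) = shift-⊢ c π

shift-IsValue : ∀ c {v} → IsValue v → IsValue (shift c v)
shift-IsValue c (var-val {x}) with x <ᵇ c
... | true  = var-val
... | false = var-val
shift-IsValue c lam-val = lam-val

-- A derivation of ƛ t, unfolded into one derivation of t per arrow of its type.
data Branches (t : Term) : Env → Pos → ℕ → Set where
  nil  : ∀ {Δ} → Δ ≈E ∅ → Branches t Δ 𝟎 0
  cons : ∀ {Δ Δ₁ Δ₂ A B L k₁ k₂}
       → Sized (A ∷ₑ Δ₁) t B k₁ → Branches t Δ₂ L k₂ → Δ ≈E (Δ₁ ⊎ Δ₂)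
       → Branches t Δ ((A ⊸ B) ∷ L) (k₁ + k₂)

Branches-resp-≈E : ∀ {t Δ Δ′ L k} → Branches t Δ L k → Δ′ ≈E Δ → Branches t Δ′ L k
Branches-resp-≈E (nil e)       e′ = nil (≈E-trans e′ e)
Branches-resp-≈E (cons d bs e) e′ = cons d bs (≈E-trans e′ e)

cons-≈N : ∀ {t Δ Δ₁ Δ₂ A B N L k₁ k₂}
        → N ≈N (A ⊸ B) → Sized (A ∷ₑ Δ₁) t B k₁ → Branches t Δ₂ L k₂ → Δ ≈E (Δ₁ ⊎ Δ₂)
        → Branches t Δ (N ∷ L) (k₁ + k₂)
cons-≈N {Δ₁ = Δ₁} (⊸-cong p q) d bs e = cons (retype d (∷ₑ-cong Δ₁ p) q) bs e

mutual
  Branches-resp-≈P : ∀ {t Δ L L′ k} → Branches t Δ L k → L ≈P L′ → Branches t Δ L′ k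
  Branches-resp-≈P bs (Perm.refl ps) = Branches-resp-pointwise bs ps
  Branches-resp-≈P (cons d bs e) (Perm.prep q p) = cons-≈N (≈N-sym q) d (Branches-resp-≈P bs p) e
  Branches-resp-≈P {t} {Δ} {L′ = L′}
    (cons {Δ₁ = Δa} {k₁ = ka} da (cons {Δ₁ = Δb} {Δ₂ = Δc} {k₁ = kb} {k₂ = k} db bs e₂) e₁)
    (Perm.swap qa qb p) =
    subst (Branches t Δ L′) (+-shifts kb ka k)
      (cons-≈N (≈N-sym qb) db (cons-≈N (≈N-sym qa) da (Branches-resp-≈P bs p) ≈E-refl) Δ≈)
    where
    Δ≈ : Δ ≈E (Δb ⊎ (Δa ⊎ Δc))
    Δ≈ y = ↭-trans (e₁ y) (↭-trans (++⁺ˡ (Δa y) (e₂ y)) (shifts (Δa y) (Δb y)))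
  Branches-resp-≈P bs (Perm.trans p q) = Branches-resp-≈P (Branches-resp-≈P bs p) q

  Branches-resp-pointwise : ∀ {t Δ L L′ k} → Branches t Δ L k → Pointwise _≈N_ L L′ → Branches t Δ L′ k
  Branches-resp-pointwise (nil e)       []       = nil e
  Branches-resp-pointwise (cons d bs e) (q ∷ ps) = cons-≈N (≈N-sym q) d (Branches-resp-pointwise bs ps) e

lam⇒Branches : ∀ {t Δ Q k} → Sized Δ (ƛ t) Q k → Branches t Δ Q k
lam⇒Branches {t} (lam n Ps Qs Γs πs e q , refl) =
  Branches-resp-≈P (Branches-resp-≈E (family⇒Branches n Ps Qs Γs πs) e) (↭-sym q)
  where
  family⇒Branches : ∀ n (Ps Qs : Fin n → Pos) (Γs : Fin n → Env)
                  → (πs : (i : Fin n) → (Ps i ∷ₑ Γs i) ⊢ t ∶ Qs i)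
                  → Branches t (⨄ Γs) (tabulate (λ i → Ps i ⊸ Qs i)) (sumFin n (λ i → size (πs i)))
  family⇒Branches zero    Ps Qs Γs πs = nil ≈E-refl
  family⇒Branches (suc n) Ps Qs Γs πs =
    cons (πs fzero , refl)
         (family⇒Branches n (λ i → Ps (fsuc i)) (λ i → Qs (fsuc i)) (λ i → Γs (fsuc i)) (λ i → πs (fsuc i)))
         ≈E-refl

Branches⇒lam : ∀ {t Δ L k} → Branches t Δ L k → Sized Δ (ƛ t) L k
Branches⇒lam (nil e) = lam 0 (λ ()) (λ ()) (λ ()) (λ ()) e (Perm.refl []) , refl
Branches⇒lam {t} (cons {Δ₁ = Δ₁} {A = A} {B = B} (π , refl) bs e) with Branches⇒lam bs
... | lam n Ps Qs Γs πs e′ q , refl =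
  lam (suc n) (A ◂ Ps) (B ◂ Qs) (Δ₁ ◂ Γs) πs′ (≈E-trans e (⊎-cong ≈E-refl e′)) (Perm.prep ≈N-refl q) , refl
  where
  πs′ : (i : Fin (suc n)) → ((A ◂ Ps) i ∷ₑ (Δ₁ ◂ Γs) i) ⊢ t ∶ (B ◂ Qs) i
  πs′ fzero    = π
  πs′ (fsuc i) = πs i

record Split (D : Env → Pos → ℕ → Set) (Δ : Env) (R₁ R₂ : Pos) (k : ℕ) : Set where
  constructor split
  field
    Δ₁ Δ₂ : Env
    k₁ k₂ : ℕ
    part₁ : D Δ₁ R₁ k₁
    part₂ : D Δ₂ R₂ k₂
    Δ≈    : Δ ≈E (Δ₁ ⊎ Δ₂)
    k≡    : k ≡ k₁ + k₂

Branches-split : ∀ {t Δ} L₁ {L₂ k} → Branches t Δ (L₁ ++ L₂) k → Split (Branches t) Δ L₁ L₂ k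
Branches-split []        {k = k} bs = split ∅ _ 0 k (nil ≈E-refl) bs ≈E-refl refl
Branches-split (N ∷ L₁) (cons {Δ₁ = Δa} {k₁ = ka} d bs e) with Branches-split L₁ bs
... | split Δ₁ Δ₂ k₁ k₂ bs₁ bs₂ Δ≈ refl =
  split (Δa ⊎ Δ₁) Δ₂ (ka + k₁) k₂ (cons d bs₁ ≈E-refl) bs₂ Δ≈′ (sym (+-assoc ka k₁ k₂))
  where
  Δ≈′ : _ ≈E ((Δa ⊎ Δ₁) ⊎ Δ₂)
  Δ≈′ y = ↭-trans (e y) (↭-trans (++⁺ˡ (Δa y) (Δ≈ y)) (↭-sym (++-assoc (Δa y) (Δ₁ y) (Δ₂ y))))

-- This is where v must be a value: an axiom or a λ-rule splits along its type, an application does not.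
split-value : ∀ {Δ v k} R₁ R₂ → IsValue v → Sized Δ v (R₁ ++ R₂) k
            → Split (λ Δ R → Sized Δ v R) Δ R₁ R₂ k
split-value R₁ R₂ var-val (ax {x = z} e q , refl) =
  split (z ∶ₑ R₁) (z ∶ₑ R₂) 0 0 (ax ≈E-refl ↭-refl , refl) (ax ≈E-refl ↭-refl , refl)
        (≈E-trans e (≈E-trans (∶ₑ-cong z (↭-sym q)) (∶ₑ-++ z R₁ R₂))) refl
split-value R₁ R₂ lam-val d with Branches-split R₁ (lam⇒Branches d)
... | split Δ₁ Δ₂ k₁ k₂ bs₁ bs₂ Δ≈ k≡ = split Δ₁ Δ₂ k₁ k₂ (Branches⇒lam bs₁) (Branches⇒lam bs₂) Δ≈ k≡

value-𝟎 : ∀ {Δ v k} → IsValue v → Sized Δ v 𝟎 k → Δ ≈E ∅ × k ≡ 0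
value-𝟎 var-val (ax {x = z} e q , refl) = ≈E-trans e (≈E-trans (∶ₑ-cong z (↭-sym q)) (∶ₑ-𝟎 z)) , refl
value-𝟎 lam-val d with lam⇒Branches d
... | nil e = e , refl

record SplitAll (v : Term) (Δ : Env) (n : ℕ) (Rs : Fin n → Pos) (k : ℕ) : Set where
  constructor splitAll
  field
    Δs    : Fin n → Env
    ks    : Fin n → ℕ
    parts : (i : Fin n) → Sized (Δs i) v (Rs i) (ks i)
    Δ≈    : Δ ≈E ⨄ Δs
    k≡    : k ≡ sumFin n ks

split-value-⨄ : ∀ n (Γs : Fin n → Env) x {Δ v k} → IsValue v → Sized Δ v (⨄ Γs x) k
              → SplitAll v Δ n (λ i → Γs i x) k
split-value-⨄ zero Γs x isValue d with value-𝟎 isValue d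
... | Δ≈∅ , k≡0 = splitAll (λ ()) (λ ()) (λ ()) Δ≈∅ k≡0
split-value-⨄ (suc n) Γs x {v = v} isValue d
  with split-value (Γs fzero x) (⨄ (λ i → Γs (fsuc i)) x) isValue d
... | split Δ₁ _ k₁ _ d₁ d′ Δ≈ refl with split-value-⨄ n (λ i → Γs (fsuc i)) x isValue d′
... | splitAll Δs ks ds Δ≈′ refl =
  splitAll (Δ₁ ◂ Δs) (k₁ ◂ ks) parts (≈E-trans Δ≈ (⊎-cong ≈E-refl Δ≈′)) refl
  where
  parts : (i : Fin (suc n)) → Sized ((Δ₁ ◂ Δs) i) v (Γs i x) ((k₁ ◂ ks) i)
  parts fzero    = d₁
  parts (fsuc i) = ds i

substitution : ∀ {Γ Δ x Q t v k} → IsValue v → (π : Γ ⊢ t ∶ Q) → Sized Δ v (Γ x) k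
             → Sized ((Γ ∖ x) ⊎ Δ) (t [ v / x ]) Q (size π + k)
substitution {Γ} {Δ} {x} {k = k} isValue (ax {x = y} {P = P} e q) d with y ≟ x
... | yes refl rewrite ≡ᵇ-refl y = retype d Γ∖y⊎Δ≈Δ (↭-trans q P≈Γy)
  where
  Γ∖y⊎Δ≈Δ : ((Γ ∖ y) ⊎ Δ) ≈E Δ
  Γ∖y⊎Δ≈Δ = ⊎-cong (≈E-trans (∖-cong y e) (∶ₑ-∖ y P)) ≈E-refl
  P≈Γy : P ≈P Γ y
  P≈Γy = ↭-sym (↭-trans (e y) (↭-reflexive (,-here ∅ y P)))
... | no y≢x rewrite ≢⇒≡ᵇ-false y≢x = ax Γ∖x⊎Δ≈y∶P q , sym (proj₂ Δ≈∅×k≡0)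
  where
  Γx≈𝟎 : Γ x ≈P 𝟎
  Γx≈𝟎 = ↭-trans (e x) (↭-reflexive (,-there ∅ y P (λ x≡y → y≢x (sym x≡y))))
  Δ≈∅×k≡0 : Δ ≈E ∅ × k ≡ 0
  Δ≈∅×k≡0 = value-𝟎 isValue (retype d ≈E-refl (↭-sym Γx≈𝟎))
  open ≈E-Reasoning
  Γ∖x⊎Δ≈y∶P : ((Γ ∖ x) ⊎ Δ) ≈E (y ∶ₑ P)
  Γ∖x⊎Δ≈y∶P = begin
    (Γ ∖ x) ⊎ Δ  ≈⟨ ⊎-cong ≈E-refl (proj₁ Δ≈∅×k≡0) ⟩
    (Γ ∖ x) ⊎ ∅  ≈⟨ ⊎-identityʳ (Γ ∖ x) ⟩
    Γ ∖ x        ≈⟨ ∖-fresh x Γx≈𝟎 ⟩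
    Γ            ≈⟨ e ⟩
    y ∶ₑ P       ∎
substitution {Γ} {Δ} {x} isValue (app {Γ₁ = Γ₁} {Γ₂ = Γ₂} π₁ π₂ e q) d
  with split-value (Γ₁ x) (Γ₂ x) isValue (retype d ≈E-refl (↭-sym (e x)))
... | split Δ₁ Δ₂ k₁ k₂ d₁ d₂ Δ≈ refl
  with substitution isValue π₁ d₁ | substitution isValue π₂ d₂
...   | ρ₁ , ρ₁-size | ρ₂ , ρ₂-size = app ρ₁ ρ₂ Γ∖x⊎Δ≈ q , size≡
  where
  open ≈E-Reasoning
  Γ∖x⊎Δ≈ : ((Γ ∖ x) ⊎ Δ) ≈E (((Γ₁ ∖ x) ⊎ Δ₁) ⊎ ((Γ₂ ∖ x) ⊎ Δ₂))
  Γ∖x⊎Δ≈ = begin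
    (Γ ∖ x) ⊎ Δ                          ≈⟨ ⊎-cong (∖-cong x e) Δ≈ ⟩
    ((Γ₁ ⊎ Γ₂) ∖ x) ⊎ (Δ₁ ⊎ Δ₂)          ≈⟨ ⊎-cong (∖-⊎ Γ₁ Γ₂ x) ≈E-refl ⟩
    ((Γ₁ ∖ x) ⊎ (Γ₂ ∖ x)) ⊎ (Δ₁ ⊎ Δ₂)    ≈⟨ ⊎-interchange (Γ₁ ∖ x) (Γ₂ ∖ x) Δ₁ Δ₂ ⟩
    ((Γ₁ ∖ x) ⊎ Δ₁) ⊎ ((Γ₂ ∖ x) ⊎ Δ₂)    ∎
  size≡ : suc (size ρ₁ + size ρ₂) ≡ suc (size π₁ + size π₂) + (k₁ + k₂)
  size≡ = cong suc (trans (cong₂ _+_ ρ₁-size ρ₂-size) (+-interchange (size π₁) k₁ (size π₂) k₂))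
substitution {Γ} {Δ} {x} {t = ƛ s} {v} isValue (lam n Ps Qs Γs πs e q) d
  with split-value-⨄ n Γs x isValue (retype d ≈E-refl (↭-sym (e x)))
... | splitAll Δs ks ds Δ≈ refl =
  lam n Ps Qs (λ i → (Γs i ∖ x) ⊎ Δs i) (λ i → proj₁ (branch i)) Γ∖x⊎Δ≈ q , size≡
  where
  branch : ∀ i → Sized (Ps i ∷ₑ ((Γs i ∖ x) ⊎ Δs i)) (s [ shift 0 v / suc x ]) (Qs i) (size (πs i) + ks i)
  branch i = retype (substitution (shift-IsValue 0 isValue) (πs i) (shift-Sized 0 (ds i)))
                    (∷ₑ-∖-⊎ (Ps i) (Γs i) (Δs i) x) ↭-refl
  open ≈E-Reasoning
  Γ∖x⊎Δ≈ : ((Γ ∖ x) ⊎ Δ) ≈E ⨄ (λ i → (Γs i ∖ x) ⊎ Δs i)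
  Γ∖x⊎Δ≈ = begin
    (Γ ∖ x) ⊎ Δ                    ≈⟨ ⊎-cong (∖-cong x e) Δ≈ ⟩
    (⨄ Γs ∖ x) ⊎ ⨄ Δs              ≈⟨ ⊎-cong (∖-⨄ n Γs x) ≈E-refl ⟩
    ⨄ (λ i → Γs i ∖ x) ⊎ ⨄ Δs      ≈⟨ ⨄-interchange n (λ i → Γs i ∖ x) Δs ⟩
    ⨄ (λ i → (Γs i ∖ x) ⊎ Δs i)    ∎
  size≡ : sumFin n (λ i → size (proj₁ (branch i))) ≡ sumFin n (λ i → size (πs i)) + sumFin n ks
  size≡ = trans (sumFin-cong n (λ i → proj₂ (branch i))) (sumFin-+ n (λ i → size (πs i)) ks)

lemma3p3 : ∀ {Γ Δ : Env} {x : ℕ} {P Q : Pos} {t v : Term}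
    → IsValue v
    → Γ x ≡ []
    → (π : (Γ , x ∶ P) ⊢ t ∶ Q)
    → (π′ : Δ ⊢ v ∶ P)
    → Σ ((Γ ⊎ Δ) ⊢ t [ v / x ] ∶ Q) (λ π″ → size π″ ≡ size π + size π′)
lemma3p3 {Γ} {Δ} {x} {P} isValue Γx≡𝟎 π π′ =
  retype (substitution isValue π (retype (π′ , refl) ≈E-refl (↭-reflexive (,-here Γ x P)))) Γ⊎Δ≈ ↭-refl
  where
  Γ⊎Δ≈ : (Γ ⊎ Δ) ≈E (((Γ , x ∶ P) ∖ x) ⊎ Δ)
  Γ⊎Δ≈ = ⊎-cong (≈E-sym (≈E-trans (,-∖ Γ x P) (∖-fresh x (↭-reflexive Γx≡𝟎)))) ≈E-refl
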